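{- Let $d\ge3$ be odd and $\mu$ a bar partition. For any $0\le i,j\le d-1$, $$NB_{j^*\to i^*}(D(\mu))=\{z^*\mid z\in B_{i\to j}(D(\mu))\}.$$ In particular, the multiset of hook lengths of $NB_{j^*\to i^*}(D(\mu))$ equals the multiset of hook lengths of $B_{i\to j}(D(\mu))$.
   Context: $\mu=(a_1>\dots>a_m>0)$ is a partition into distinct parts. $D(\mu)$ is the partition with Frobenius symbol $(a_1,\dots,a_m\mid a_1-1,\dots,a_m-1)$; for $r\le m$, row $r$ has length $a_r+r$ and column $r$ has length $a_r+r-1$. Young diagrams are in English convention, with node $(r,c)$ in row $r$, column $c$. The hook at node $(r,c)$ of a partition $\nu$ has hand node $(r,\nu_r)$ and foot node $(\nu'_c,c)$. The residue of node $(r,c)$ is $[c-r]_d$, the least non-negative residue mod $d$. $H_{i\to j}(\nu)$ is the set of hooks with hand residue $i$ and foot residue $[j+1]_d$. $B(D(\mu))$ is the set of hooks of $D(\mu)$ at the nodes $(r,c)$ with $1\le r\le m$, $r<c\le r+a_r$, $c\ne m+1$. $NB(D(\mu))$ is the set of hooks of $D(\mu)$ at nodes $(r,c)$ with $r>c$. For $X\in\{B,NB\}$, write $X_{i\to j}(D(\mu))=X(D(\mu))\cap H_{i\to j}(D(\mu))$. For the hook $z$ at node $(r,c)$ of $B(D(\mu))$, $z^*$ denotes the hook at node $(c,r)$ if $c\le m$, and at node $(c-1,r)$ if $c\ge m+2$. The hooks $z^*$ run exactly over $NB(D(\mu))$, and $z^*$ has the same length as $z$. $i^*=d-i$ for $1\le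 i\le d-1$, and $0^*=0$. -}

module Defs where

open import Data.Bool.Base using (Bool; true; false; _∧_; not; if_then_else_)
open import Data.Nat.Base using (ℕ; zero; suc; _+_; _∸_; _≤ᵇ_; _<ᵇ_; _≡ᵇ_)
open import Data.Integer.Base using (+_; _-_)
open import Data.Integer.DivMod using (_%ℕ_)
open import Data.Nat.ListAction using (sum)
open import Data.List.Base using (List; []; _∷_; length; map; upTo; filterᵇ; cartesianProduct)
open import Data.Product using (_×_; _,_)

-- A node (r , c) of a Young diagram: row r, column c (1-indexed, English convention).
Node : Set
Node = ℕ × ℕ

nParts : List ℕ → ℕ
nParts = length

-- part μ r = a_r  (1-indexed; 0 outside 1..m)
part : List ℕ → ℕ → ℕ
part []       _             = 0
part (x ∷ xs) zero          = 0
part (x ∷ xs) (suc zero)    = x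
part (x ∷ xs) (suc (suc k)) = part xs (suc k)

-- Membership of node (r , c) in D(μ), the partition with Frobenius symbol
-- (a_1,...,a_m | a_1 - 1, ..., a_m - 1):
--   r ≤ c : node on/right of the diagonal, r ≤ m and c - r ≤ α_r = a_r
--   r > c : node below the diagonal,      c ≤ m and r - c ≤ β_c = a_c - 1
inD : List ℕ → ℕ → ℕ → Bool
inD μ r c =
  (1 ≤ᵇ r) ∧ (1 ≤ᵇ c) ∧
  (if r ≤ᵇ c
     then (r ≤ᵇ nParts μ) ∧ (c ≤ᵇ r + part μ r)
     else (c ≤ᵇ nParts μ) ∧ (r <ᵇ c + part μ c))

bound : List ℕ → ℕ
bound μ = sum μ + nParts μ + 1

range : List ℕ → List ℕ
range μ = map suc (upTo (bound μ))

box : List ℕ → List Node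
box μ = cartesianProduct (range μ) (range μ)

rowLen : List ℕ → ℕ → ℕ
rowLen μ r = length (filterᵇ (λ c → inD μ r c) (range μ))

colLen : List ℕ → ℕ → ℕ
colLen μ c = length (filterᵇ (λ r → inD μ r c) (range μ))

hookLen : List ℕ → Node → ℕ
hookLen μ (r , c) = rowLen μ r ∸ c + (colLen μ c ∸ r) + 1

-- residue of node (r , c) : [c - r]_d  (least non-negative residue; d = 0 is a dummy case)
res : ℕ → ℕ → ℕ → ℕ
res zero    r c = 0
res (suc k) r c = ((+ c) - (+ r)) %ℕ (suc k)

star : ℕ → ℕ → ℕ
star d zero    = 0
star d (suc i) = d ∸ suc i

-- hook at (r , c) lies in H_{i→j}(D(μ)):
-- hand node (r , ν_r) has residue i, foot node (ν'_c , c) has residue [j+1]_d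
inH : ℕ → List ℕ → ℕ → ℕ → Node → Bool
inH d μ i j (r , c) =
  (res d r (rowLen μ r) ≡ᵇ i) ∧ (res d (colLen μ c) c ≡ᵇ res d 0 (suc j))

inB : List ℕ → Node → Bool
inB μ (r , c) =
  (1 ≤ᵇ r) ∧ (r ≤ᵇ nParts μ) ∧ (r <ᵇ c) ∧ (c ≤ᵇ r + part μ r)
  ∧ not (c ≡ᵇ suc (nParts μ))

inNB : List ℕ → Node → Bool
inNB μ (r , c) = (c <ᵇ r) ∧ inD μ r c

inBij : ℕ → List ℕ → ℕ → ℕ → Node → Bool
inBij d μ i j z = inB μ z ∧ inH d μ i j z

inNBij : ℕ → List ℕ → ℕ → ℕ → Node → Bool
inNBij d μ i j z = inNB μ z ∧ inH d μ i j z

zstar : List ℕ → Node → Node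
zstar μ (r , c) = if c ≤ᵇ nParts μ then (c , r) else (c ∸ 1 , r)

-- For r ≤ m, row r of D(μ) has length r + a_r and column r has length r - 1 + a_r, while for
-- R > m row R has the same length as column R + 1.  So the hand node of row c and the foot node
-- of column c (c ≤ m), and likewise the foot node of column R + 1 and the hand node of row R
-- (R > m), have contents (column minus row) summing to 1: their residues t and [1 - t]_d
-- determine each other.  For z = (r , c), the hook z* = (c , r) (or (c - 1 , r)) has its hand
-- in the row paired with column c, which holds the foot of z, and its foot in column r, paired
-- with row r, which holds the hand of z.  As [1 - i]_d = [i* + 1]_d and [1 - (j + 1)]_d = j*,
-- z lies in H_{i→j} iff z* lies in H_{j*→i*}.  The same lengths show that z ↦ z* preserves
-- hook lengths, and (R , C) ↦ (C , R) for R ≤ m, (C , R + 1) for R > m inverts it, which turns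
-- the bijection into the equality of multisets of hook lengths.

module Submission where

open import Defs
open import Data.Nat.Base using (ℕ)
open import Data.Bool.Base using (true)
open import Data.List.Base using (List; map; filterᵇ)
open import Data.List.Relation.Unary.All using (All; _∷_)
open import Data.List.Relation.Unary.Linked using (Linked)
open import Data.List.Relation.Binary.Permutation.Propositional using (_↭_)
open import Data.Product using (_×_; _,_; ∃-syntax; proj₂)
open import Function.Bundles using (_⇔_)
open import Relation.Binary.PropositionalEquality using (_≡_)

open import Function.Bundles using (mk⇔; Equivalence)
open import Relation.Binary.PropositionalEquality using (refl; sym; trans; cong; cong₂; subst; module ≡-Reasoning)

module Residue where

  open import Data.Nat.Base as ℕ using (zero; suc; s≤s)
  import Data.Nat.Properties as ℕ
  open import Data.Nat.DivMod using (m<n⇒m%n≡m; [m+n]%n≡m%n; n%n≡0)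
  open import Data.Integer.Base using (+_; -[1+_]; _+_; _-_; _*_; -_; _%ℕ_; _/ℕ_)
  open import Data.Integer.Properties using (⊖-≥; ⊖-<; m-n≡m⊖n; +-identityʳ)
  open import Data.Integer.DivMod using (n%ℕd<d; a≡a%ℕn+[a/ℕn]*n)
  open import Data.Integer.Tactic.RingSolver using (solve-∀)
  open import Relation.Binary.Definitions using (tri<; tri≈; tri>)
  open ≡-Reasoning

  -- The modulus is written suc k throughout, so that res (suc k) computes.

  private
    suc[k+o]∸k≡suc[o] : ∀ k o → suc (k ℕ.+ o) ℕ.∸ k ≡ suc o
    suc[k+o]∸k≡suc[o] k o = trans (cong (ℕ._∸ k) (sym (ℕ.+-suc k o))) (ℕ.m+n∸m≡n k (suc o))

    suc[suc[k+o]]≡suc[o]+suc[k] : ∀ k o → suc (suc (k ℕ.+ o)) ≡ suc o ℕ.+ suc k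
    suc[suc[k+o]]≡suc[o]+suc[k] k o = cong suc (trans (cong suc (ℕ.+-comm k o)) (sym (ℕ.+-suc o k)))

  [n+d]%ℕd≡n%ℕd : ∀ k n → (n + + suc k) %ℕ suc k ≡ n %ℕ suc k
  [n+d]%ℕd≡n%ℕd k (+ n) = [m+n]%n≡m%n n (suc k)
  -- -[1+ n ] %ℕ d is defined through suc n % d, whence the comparison of n with k.
  [n+d]%ℕd≡n%ℕd k -[1+ n ] with ℕ.<-cmp n k
  ... | tri< n<k _ _
    rewrite ⊖-≥ {suc k} {suc n} (s≤s (ℕ.<⇒≤ n<k)) | m<n⇒m%n≡m {suc k} {suc n} (s≤s n<k)
    = m<n⇒m%n≡m (s≤s (ℕ.m∸n≤m k n))
  ... | tri≈ _ refl _
    rewrite ⊖-≥ {suc k} {suc k} ℕ.≤-refl | n%n≡0 (suc k) ⦃ _ ⦄ | ℕ.n∸n≡0 k = refl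
  ... | tri> _ _ k<n with ℕ.m≤n⇒∃[o]m+o≡n k<n
  ...   | o , refl rewrite ⊖-< {suc k} {suc (suc (k ℕ.+ o))} (s≤s k<n)
                         | suc[k+o]∸k≡suc[o] k o | suc[suc[k+o]]≡suc[o]+suc[k] k o
                         | [m+n]%n≡m%n (suc o) (suc k) ⦃ _ ⦄ = refl

  [n+m*d]%ℕd≡n%ℕd : ∀ k m n → (n + + m * + suc k) %ℕ suc k ≡ n %ℕ suc k
  [n+m*d]%ℕd≡n%ℕd k zero    n = cong (_%ℕ suc k) (+-identityʳ n)
  [n+m*d]%ℕd≡n%ℕd k (suc m) n = begin
    (n + + suc m * + suc k) %ℕ suc k         ≡⟨ cong (_%ℕ suc k) (split n (+ m) (+ suc k)) ⟩
    (n + + m * + suc k + + suc k) %ℕ suc k   ≡⟨ [n+d]%ℕd≡n%ℕd k (n + + m * + suc k) ⟩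
    (n + + m * + suc k) %ℕ suc k             ≡⟨ [n+m*d]%ℕd≡n%ℕd k m n ⟩
    n %ℕ suc k                               ∎
    where
    split : ∀ n m d → n + (+ 1 + m) * d ≡ n + m * d + d
    split = solve-∀

  [n+q*d]%ℕd≡n%ℕd : ∀ k q n → (n + q * + suc k) %ℕ suc k ≡ n %ℕ suc k
  [n+q*d]%ℕd≡n%ℕd k (+ m)    n = [n+m*d]%ℕd≡n%ℕd k m n
  [n+q*d]%ℕd≡n%ℕd k -[1+ m ] n = sym (begin
    n %ℕ suc k
      ≡⟨ cong (_%ℕ suc k) (cancel n (+ m) (+ suc k)) ⟩
    (n + -[1+ m ] * + suc k + + suc m * + suc k) %ℕ suc k
      ≡⟨ [n+m*d]%ℕd≡n%ℕd k (suc m) (n + -[1+ m ] * + suc k) ⟩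
    (n + -[1+ m ] * + suc k) %ℕ suc k
      ∎)
    where
    cancel : ∀ n m d → n ≡ n + - (+ 1 + m) * d + (+ 1 + m) * d
    cancel = solve-∀

  [m-n]%ℕd≡[m-n%ℕd]%ℕd : ∀ k m n → (m - n) %ℕ suc k ≡ (m - + (n %ℕ suc k)) %ℕ suc k
  [m-n]%ℕd≡[m-n%ℕd]%ℕd k m n = begin
    (m - n) %ℕ suc k                    ≡⟨ cong (λ t → (m - t) %ℕ suc k) (a≡a%ℕn+[a/ℕn]*n n (suc k)) ⟩
    (m - (+ r + q * + suc k)) %ℕ suc k  ≡⟨ cong (_%ℕ suc k) (regroup m (+ r) q (+ suc k)) ⟩
    (m - + r + - q * + suc k) %ℕ suc k  ≡⟨ [n+q*d]%ℕd≡n%ℕd k (- q) (m - + r) ⟩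
    (m - + r) %ℕ suc k                  ∎
    where
    r = n %ℕ suc k
    q = n /ℕ suc k
    regroup : ∀ m r q d → m - (r + q * d) ≡ m - r + - q * d
    regroup = solve-∀

  oneMinus : ℕ → ℕ → ℕ
  oneMinus d t = res d t 1

  -- y + v ≡ suc (x + u) says that the contents y - x and v - u of the nodes (x , y) and
  -- (u , v) sum to 1.
  res-adjacent : ∀ k x y u v → y ℕ.+ v ≡ suc (x ℕ.+ u) →
                 res (suc k) u v ≡ oneMinus (suc k) (res (suc k) x y)
  res-adjacent k x y u v y+v≡1+x+u = begin
    (+ v - + u) %ℕ suc k
      ≡⟨ cong (_%ℕ suc k) (complement (+ x) (+ y) (+ u) (+ v) (cong +_ y+v≡1+x+u)) ⟩
    (+ 1 - (+ y - + x)) %ℕ suc k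
      ≡⟨ [m-n]%ℕd≡[m-n%ℕd]%ℕd k (+ 1) (+ y - + x) ⟩
    oneMinus (suc k) (res (suc k) x y) ∎
    where
    complement : ∀ x y u v → y + v ≡ + 1 + (x + u) → v - u ≡ + 1 - (y - x)
    complement x y u v e = begin
      v - u                                 ≡⟨ regroup x y u v ⟩
      (y + v) - (x + u) - (y - x)           ≡⟨ cong (λ t → t - (x + u) - (y - x)) e ⟩
      (+ 1 + (x + u)) - (x + u) - (y - x)   ≡⟨ cancel (x + u) (y - x) ⟩
      + 1 - (y - x)                         ∎
      where
      regroup : ∀ x y u v → v - u ≡ (y + v) - (x + u) - (y - x)
      regroup = solve-∀
      cancel : ∀ a b → (+ 1 + a) - a - b ≡ + 1 - b
      cancel = solve-∀

  oneMinus-involutive : ∀ k {t} → t ℕ.< suc k → oneMinus (suc k) (oneMinus (suc k) t) ≡ t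
  oneMinus-involutive k {t} t<d = begin
    (+ 1 - + ((+ 1 - + t) %ℕ suc k)) %ℕ suc k  ≡⟨ [m-n]%ℕd≡[m-n%ℕd]%ℕd k (+ 1) (+ 1 - + t) ⟨
    (+ 1 - (+ 1 - + t)) %ℕ suc k               ≡⟨ cong (_%ℕ suc k) (1-[1-t]≡t (+ t)) ⟩
    t ℕ.% suc k                                ≡⟨ m<n⇒m%n≡m t<d ⟩
    t                                          ∎
    where
    1-[1-t]≡t : ∀ t → + 1 - (+ 1 - t) ≡ t
    1-[1-t]≡t = solve-∀

  res-adjacent-⇔ : ∀ k x y u v {i i′} → y ℕ.+ v ≡ suc (x ℕ.+ u) → i ℕ.< suc k →
                   oneMinus (suc k) i ≡ i′ → res (suc k) x y ≡ i ⇔ res (suc k) u v ≡ i′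
  res-adjacent-⇔ k x y u v {i} y+v≡1+x+u i<d refl = mk⇔
    (λ { refl → res-adjacent k x y u v y+v≡1+x+u })
    (λ r≡ → begin
      res (suc k) x y                              ≡⟨ res-adjacent k u v x y v+y≡1+u+x ⟩
      oneMinus (suc k) (res (suc k) u v)           ≡⟨ cong (oneMinus (suc k)) r≡ ⟩
      oneMinus (suc k) (oneMinus (suc k) i)        ≡⟨ oneMinus-involutive k i<d ⟩
      i                                            ∎)
    where
    v+y≡1+u+x : v ℕ.+ y ≡ suc (u ℕ.+ x)
    v+y≡1+u+x = trans (ℕ.+-comm v y) (trans y+v≡1+x+u (cong suc (ℕ.+-comm x u)))

  oneMinus-star : ∀ k {i} → i ℕ.< suc k → oneMinus (suc k) i ≡ res (suc k) 0 (suc (star (suc k) i))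
  oneMinus-star k {zero}  _         = refl
  oneMinus-star k {suc i} (s≤s i<k) = sym (begin
    (+ suc (k ℕ.∸ i) - + 0) %ℕ suc k       ≡⟨ cong (λ t → (+ 1 + t - + 0) %ℕ suc k) k∸i≡k-i ⟩
    (+ 1 + (+ k - + i) - + 0) %ℕ suc k     ≡⟨ cong (_%ℕ suc k) (regroup (+ k) (+ i)) ⟩
    (+ 1 - + suc i + + suc k) %ℕ suc k     ≡⟨ [n+d]%ℕd≡n%ℕd k (+ 1 - + suc i) ⟩
    (+ 1 - + suc i) %ℕ suc k               ∎)
    where
    k∸i≡k-i : + (k ℕ.∸ i) ≡ + k - + i
    k∸i≡k-i = sym (trans (m-n≡m⊖n k i) (⊖-≥ (ℕ.<⇒≤ i<k)))
    regroup : ∀ k i → + 1 + (k - i) - + 0 ≡ + 1 - (+ 1 + i) + (+ 1 + k)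
    regroup = solve-∀

  [1-[1+j]]%ℕd≡star : ∀ k {j} → j ℕ.< suc k → (+ 1 - + suc j) %ℕ suc k ≡ star (suc k) j
  [1-[1+j]]%ℕd≡star k {zero}  _      = refl
  [1-[1+j]]%ℕd≡star k {suc j} 1+j<d rewrite m<n⇒m%n≡m {suc k} {suc j} 1+j<d = refl

  oneMinus-res-suc : ∀ k {j} → j ℕ.< suc k → oneMinus (suc k) (res (suc k) 0 (suc j)) ≡ star (suc k) j
  oneMinus-res-suc k {j} j<d = begin
    (+ 1 - + ((+ suc j - + 0) %ℕ suc k)) %ℕ suc k
      ≡⟨ [m-n]%ℕd≡[m-n%ℕd]%ℕd k (+ 1) (+ suc j - + 0) ⟨
    (+ 1 - (+ suc j - + 0)) %ℕ suc k
      ≡⟨ cong (λ t → (+ 1 - t) %ℕ suc k) (+-identityʳ (+ suc j)) ⟩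
    (+ 1 - + suc j) %ℕ suc k
      ≡⟨ [1-[1+j]]%ℕd≡star k j<d ⟩
    star (suc k) j
      ∎

  res<d : ∀ k x y → res (suc k) x y ℕ.< suc k
  res<d k x y = n%ℕd<d (+ y - + x) (suc k)

open Residue

open import Data.Bool.Base using (Bool; false; T; _∧_; not; if_then_else_)
open import Data.Bool.Properties using (T-≡; T-not-≡; ∧-conicalˡ; ∧-conicalʳ)
open import Data.Nat.Base
open import Data.Nat.Properties
open import Data.Nat.ListAction using (sum)
open import Data.Nat.Tactic.RingSolver using (solve-∀)
open import Data.List.Base using ([]; _∷_; _++_; length; upTo)
open import Data.List.Properties
  using (upTo-∷ʳ; map-++; length-++; filter-++; map-∘; map-id-local; map-cong-local)
import Data.List.Relation.Unary.All as All
open import Data.List.Relation.Unary.All.Properties using (all-filter)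
open import Data.List.Relation.Unary.Linked using (_∷_)
open import Data.List.Relation.Unary.Unique.Propositional using (Unique)
import Data.List.Relation.Unary.Unique.Propositional.Properties as Unique
open import Data.List.Membership.Propositional using (_∈_)
open import Data.List.Membership.Propositional.Properties
  using (∈-map⁺; ∈-map⁻; ∈-upTo⁺; ∈-cartesianProduct⁺; ∈-filter⁺; ∈-filter⁻)
open import Data.List.Membership.Propositional.Properties.WithK using (unique∧set⇒bag)
open import Data.List.Relation.Binary.BagAndSetEquality using (∼bag⇒↭)
import Data.List.Relation.Binary.Permutation.Propositional.Properties as ↭
open import Function.Base using (_∘_)
open import Function.Construct.Composition using (_⇔-∘_)
open import Function.Construct.Symmetry using (⇔-sym)
open import Relation.Nullary using (¬_; yes; no; contradiction)
open import Relation.Nullary.Decidable using (T?)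
open import Relation.Binary.PropositionalEquality using (_≢_)

open Equivalence using (to; from)

¬T⇒≡false : ∀ {b} → ¬ T b → b ≡ false
¬T⇒≡false {false} _   = refl
¬T⇒≡false {true}  ¬tt with () ← ¬tt _

≤⇒≤ᵇ≡true : ∀ {m n} → m ≤ n → (m ≤ᵇ n) ≡ true
≤⇒≤ᵇ≡true = to T-≡ ∘ ≤⇒≤ᵇ

>⇒≤ᵇ≡false : ∀ {m n} → n < m → (m ≤ᵇ n) ≡ false
>⇒≤ᵇ≡false {m} {n} n<m = ¬T⇒≡false (<⇒≱ n<m ∘ ≤ᵇ⇒≤ m n)

<⇒<ᵇ≡true : ∀ {m n} → m < n → (m <ᵇ n) ≡ true
<⇒<ᵇ≡true = to T-≡ ∘ <⇒<ᵇ

≤ᵇ≡true⇔≤ : ∀ {m n} → (m ≤ᵇ n) ≡ true ⇔ m ≤ n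
≤ᵇ≡true⇔≤ {m} {n} = mk⇔ (≤ᵇ⇒≤ m n ∘ from T-≡) ≤⇒≤ᵇ≡true

<ᵇ≡true⇔< : ∀ {m n} → (m <ᵇ n) ≡ true ⇔ m < n
<ᵇ≡true⇔< {m} {n} = mk⇔ (<ᵇ⇒< m n ∘ from T-≡) <⇒<ᵇ≡true

≡ᵇ≡true⇔≡ : ∀ {m n} → (m ≡ᵇ n) ≡ true ⇔ m ≡ n
≡ᵇ≡true⇔≡ {m} {n} = mk⇔ (≡ᵇ⇒≡ m n ∘ from T-≡) (to T-≡ ∘ ≡⇒≡ᵇ m n)

not[≡ᵇ]≡true⇔≢ : ∀ {m n} → not (m ≡ᵇ n) ≡ true ⇔ m ≢ n
not[≡ᵇ]≡true⇔≢ {m} {n} = mk⇔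
  (λ e m≡n → subst T (to T-not-≡ (from T-≡ e)) (≡⇒≡ᵇ m n m≡n))
  (λ m≢n → cong not (¬T⇒≡false (m≢n ∘ ≡ᵇ⇒≡ m n)))

infixr 6 _∧-⇔_

_∧-⇔_ : ∀ {x y} {A B : Set} → x ≡ true ⇔ A → y ≡ true ⇔ B → x ∧ y ≡ true ⇔ (A × B)
_∧-⇔_ {x} {y} p q = mk⇔
  (λ e → to p (∧-conicalˡ x y e) , to q (∧-conicalʳ x y e))
  (λ (a , b) → cong₂ _∧_ (from p a) (from q b))

⇔-swap-× : ∀ {A B A′ B′ : Set} → A ⇔ A′ → B ⇔ B′ → (A × B) ⇔ (B′ × A′)
⇔-swap-× p q = mk⇔ (λ (x , y) → to q y , to p x) (λ (y′ , x′) → from p x′ , from q y′)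

∧-cong-⇔ : ∀ {x y x′ y′} → x ≡ true ⇔ x′ ≡ true → (x ≡ true → y ≡ true ⇔ y′ ≡ true) →
           x ∧ y ≡ true ⇔ x′ ∧ y′ ≡ true
∧-cong-⇔ {x} {y} {x′} {y′} p q = mk⇔
  (λ e → cong₂ _∧_ (to p (∧-conicalˡ x y e)) (to (q (∧-conicalˡ x y e)) (∧-conicalʳ x y e)))
  (λ e → let x≡true = from p (∧-conicalˡ x′ y′ e)
         in cong₂ _∧_ x≡true (from (q x≡true) (∧-conicalʳ x′ y′ e)))

filterᵇ-cong-map : ∀ {A B : Set} (f : A → B) {p q : B → Bool} → (∀ x → p (f x) ≡ q (f x)) →
                   ∀ xs → filterᵇ p (map f xs) ≡ filterᵇ q (map f xs)
filterᵇ-cong-map f p≗q []       = refl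
filterᵇ-cong-map f {q = q} p≗q (x ∷ xs) rewrite p≗q x with q (f x)
... | true  = cong (f x ∷_) (filterᵇ-cong-map f p≗q xs)
... | false = filterᵇ-cong-map f p≗q xs

length-filterᵇ-≤ᵇ : ∀ K N → length (filterᵇ (_≤ᵇ K) (map suc (upTo N))) ≡ K ⊓ N
length-filterᵇ-≤ᵇ K zero    = sym (⊓-zeroʳ K)
length-filterᵇ-≤ᵇ K (suc N) = begin
  length (filterᵇ (_≤ᵇ K) (map suc (upTo (suc N))))
    ≡⟨ cong (λ ns → length (filterᵇ (_≤ᵇ K) (map suc ns))) (upTo-∷ʳ N) ⟨
  length (filterᵇ (_≤ᵇ K) (map suc (upTo N ++ N ∷ [])))
    ≡⟨ cong (length ∘ filterᵇ (_≤ᵇ K)) (map-++ suc (upTo N) (N ∷ [])) ⟩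
  length (filterᵇ (_≤ᵇ K) (map suc (upTo N) ++ suc N ∷ []))
    ≡⟨ cong length (filter-++ (T? ∘ (_≤ᵇ K)) (map suc (upTo N)) (suc N ∷ [])) ⟩
  length (filterᵇ (_≤ᵇ K) (map suc (upTo N)) ++ filterᵇ (_≤ᵇ K) (suc N ∷ []))
    ≡⟨ length-++ (filterᵇ (_≤ᵇ K) (map suc (upTo N))) ⟩
  length (filterᵇ (_≤ᵇ K) (map suc (upTo N))) + length (filterᵇ (_≤ᵇ K) (suc N ∷ []))
    ≡⟨ cong (_+ length (filterᵇ (_≤ᵇ K) (suc N ∷ []))) (length-filterᵇ-≤ᵇ K N) ⟩
  K ⊓ N + length (filterᵇ (_≤ᵇ K) (suc N ∷ []))
    ≡⟨ last K N ⟩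
  K ⊓ suc N ∎
  where
  open ≡-Reasoning
  last : ∀ K N → K ⊓ N + length (filterᵇ (_≤ᵇ K) (suc N ∷ [])) ≡ K ⊓ suc N
  last K N with suc N ≤? K
  ... | yes N<K rewrite ≤⇒≤ᵇ≡true N<K | m≥n⇒m⊓n≡n (<⇒≤ N<K) | m≥n⇒m⊓n≡n N<K = +-comm N 1
  ... | no N≮K rewrite >⇒≤ᵇ≡false (≰⇒> N≮K) | m≤n⇒m⊓n≡m (≮⇒≥ N≮K)
                     | m≤n⇒m⊓n≡m (m≤n⇒m≤1+n (≮⇒≥ N≮K)) = +-identityʳ K

all-filterᵇ : ∀ {A : Set} (p : A → Bool) xs → All (λ x → p x ≡ true) (filterᵇ p xs)
all-filterᵇ p xs = All.map (to T-≡) (all-filter (T? ∘ p) xs)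

filterᵇ↭map : ∀ {A B : Set} {p : B → Bool} {q : A → Bool} {f : A → B} {g : B → A}
                {ys : List B} {xs : List A} →
              Unique ys → Unique xs →
              (∀ {y} → p y ≡ true → y ∈ ys) → (∀ {x} → q x ≡ true → x ∈ xs) →
              (∀ {x} → q x ≡ true → g (f x) ≡ x) →
              (∀ y → p y ≡ true ⇔ (∃[ x ] ((q x ≡ true) × (f x ≡ y)))) →
              filterᵇ p ys ↭ map f (filterᵇ q xs)
filterᵇ↭map {p = p} {q} {f} {g} {ys} {xs} ys! xs! p⇒∈ys q⇒∈xs g∘f≡id p⇔image =
  ∼bag⇒↭ (unique∧set⇒bag (Unique.filter⁺ (T? ∘ p) ys!) image! (mk⇔ forward backward))
  where
  qs = filterᵇ q xs
  image! : Unique (map f qs)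
  image! = Unique.map⁻ (subst Unique qs≡g[f[qs]] (Unique.filter⁺ (T? ∘ q) xs!))
    where
    qs≡g[f[qs]] : qs ≡ map g (map f qs)
    qs≡g[f[qs]] = trans (sym (map-id-local (All.map g∘f≡id (all-filterᵇ q xs)))) (map-∘ qs)
  forward : ∀ {y} → y ∈ filterᵇ p ys → y ∈ map f qs
  forward y∈ with _ , py ← ∈-filter⁻ (T? ∘ p) {xs = ys} y∈
             with x , qx , refl ← to (p⇔image _) (to T-≡ py)
    = ∈-map⁺ f (∈-filter⁺ (T? ∘ q) (q⇒∈xs qx) (from T-≡ qx))
  backward : ∀ {y} → y ∈ map f qs → y ∈ filterᵇ p ys
  backward y∈ with x , x∈qs , refl ← ∈-map⁻ f y∈
              with _ , qx ← ∈-filter⁻ (T? ∘ q) {xs = xs} x∈qs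
    = let p[fx] = from (p⇔image (f x)) (x , to T-≡ qx , refl)
      in ∈-filter⁺ (T? ∘ p) (p⇒∈ys p[fx]) (from T-≡ p[fx])

part-positive : ∀ {μ} → All (0 <_) μ → ∀ {r} → 1 ≤ r → r ≤ length μ → 0 < part μ r
part-positive (0<a ∷ _)  {suc zero}    _ _         = 0<a
part-positive (_ ∷ 0<as) {suc (suc r)} _ (s≤s r<m) = part-positive 0<as (s≤s z≤n) r<m

part-step : ∀ {μ} → Linked _>_ μ → ∀ {s} → 1 ≤ s → suc s ≤ length μ → part μ (suc s) < part μ s
part-step {a ∷ b ∷ _} (a>b ∷ _)          {suc zero}    _ _         = a>b
part-step {a ∷ b ∷ _} (_ ∷ decreasing) {suc (suc s)} _ (s≤s s<m) = part-step decreasing (s≤s z≤n) s<m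
part-step {a ∷ []}    _                  {suc zero}    _ (s≤s ())

part+index-antitone : ∀ {μ} → Linked _>_ μ → ∀ {r s} → 1 ≤ r → r ≤ s → s ≤ length μ →
                      part μ s + s ≤ part μ r + r
part+index-antitone {μ} decreasing {r} 1≤r r≤s = antitone (≤⇒≤′ r≤s)
  where
  antitone : ∀ {s} → r ≤′ s → s ≤ length μ → part μ s + s ≤ part μ r + r
  antitone ≤′-refl                       _   = ≤-refl
  antitone {suc s} (≤′-step r≤s) s<m = ≤-trans
    (≤-reflexive (+-suc (part μ (suc s)) s))
    (≤-trans (+-monoˡ-≤ s (part-step decreasing (≤-trans 1≤r (≤′⇒≤ r≤s)) s<m))
             (antitone r≤s (<⇒≤ s<m)))

part≤sum : ∀ μ r → part μ r ≤ sum μ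
part≤sum []       r             = z≤n
part≤sum (a ∷ as) zero          = z≤n
part≤sum (a ∷ as) (suc zero)    = m≤m+n a (sum as)
part≤sum (a ∷ as) (suc (suc r)) = ≤-trans (part≤sum as (suc r)) (m≤n+m (sum as) a)

≰∧≢⇒> : ∀ {c m} → suc c ≰ m → suc c ≢ suc m → m < c
≰∧≢⇒> c≰m c≢m = ≤∧≢⇒< (≤-pred (≰⇒> c≰m)) (c≢m ∘ cong suc ∘ sym)

[r+A∸c]+[c+B∸1+r]+1≡A+B : ∀ {r c} A B → c ≤ r + A → r < c + B →
                          r + A ∸ c + (c + B ∸ suc r) + 1 ≡ A + B
[r+A∸c]+[c+B∸1+r]+1≡A+B {r} {c} A B c≤r+A r<c+B = +-cancelʳ-≡ (c + r) _ _ (begin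
  (X + Y + 1) + (c + r)    ≡⟨ regroup X Y c r ⟩
  (X + c) + (Y + suc r)    ≡⟨ cong₂ _+_ (m∸n+n≡m c≤r+A) (m∸n+n≡m r<c+B) ⟩
  (r + A) + (c + B)        ≡⟨ regroup′ r A c B ⟩
  (A + B) + (c + r)        ∎)
  where
  open ≡-Reasoning
  X = r + A ∸ c
  Y = c + B ∸ suc r
  regroup : ∀ X Y c r → X + Y + 1 + (c + r) ≡ X + c + (Y + suc r)
  regroup = solve-∀
  regroup′ : ∀ r A c B → r + A + (c + B) ≡ A + B + (c + r)
  regroup′ = solve-∀

module BarDiagram (μ : List ℕ) (decreasing : Linked _>_ μ) (positive : All (0 <_) μ) where

  m : ℕ
  m = nParts μ

  a : ℕ → ℕ
  a = part μ

  N : ℕ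
  N = bound μ

  ≤⇒<+part : ∀ {r s} → 1 ≤ r → r ≤ s → s ≤ m → s < r + a r
  ≤⇒<+part {r} {s} 1≤r r≤s s≤m = begin-strict
    s          <⟨ m<m+n s (part-positive positive (≤-trans 1≤r r≤s) s≤m) ⟩
    s + a s    ≡⟨ +-comm s (a s) ⟩
    a s + s    ≤⟨ part+index-antitone decreasing 1≤r r≤s s≤m ⟩
    a r + r    ≡⟨ +-comm (a r) r ⟩
    r + a r    ∎
    where open ≤-Reasoning

  m+sum≤N : m + sum μ ≤ N
  m+sum≤N = ≤-trans (≤-reflexive (+-comm m (sum μ))) (m≤m+n (sum μ + m) 1)

  m≤N : m ≤ N
  m≤N = ≤-trans (m≤m+n m (sum μ)) m+sum≤N

  r+a≤N : ∀ {r} → r ≤ m → r + a r ≤ N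
  r+a≤N {r} r≤m = ≤-trans (+-mono-≤ r≤m (part≤sum μ r)) m+sum≤N

  inD-row : ∀ {r} → 1 ≤ r → r ≤ m → ∀ c → inD μ r (suc c) ≡ (suc c ≤ᵇ r + a r)
  inD-row {r} 1≤r r≤m c with r ≤? suc c
  ... | yes r≤c rewrite ≤⇒≤ᵇ≡true 1≤r | ≤⇒≤ᵇ≡true r≤c | ≤⇒≤ᵇ≡true r≤m = refl
  ... | no r≰c rewrite ≤⇒≤ᵇ≡true 1≤r | >⇒≤ᵇ≡false (≰⇒> r≰c)
                     | ≤⇒≤ᵇ≡true (≤-trans (<⇒≤ (≰⇒> r≰c)) r≤m)
                     | ≤⇒≤ᵇ≡true (≤-trans (<⇒≤ (≰⇒> r≰c)) (m≤m+n r (a r)))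
                     | <⇒<ᵇ≡true (≤⇒<+part (s≤s z≤n) (<⇒≤ (≰⇒> r≰c)) r≤m) = refl

  inD-col : ∀ {c} → suc c ≤ m → ∀ r → inD μ (suc r) (suc c) ≡ (suc r ≤ᵇ c + a (suc c))
  inD-col {c} c<m r with suc r ≤? suc c
  ... | yes r≤c rewrite ≤⇒≤ᵇ≡true r≤c | ≤⇒≤ᵇ≡true (≤-trans r≤c c<m)
                      | ≤⇒≤ᵇ≡true (<⇒≤ (≤⇒<+part (s≤s z≤n) r≤c c<m))
                      | ≤⇒≤ᵇ≡true (≤-trans r≤c (≤-pred (≤⇒<+part (s≤s z≤n) ≤-refl c<m))) = refl
  ... | no r≰c rewrite >⇒≤ᵇ≡false (≰⇒> r≰c) | ≤⇒≤ᵇ≡true c<m = refl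

  inD-beyond : ∀ {R} → m < R → ∀ c → inD μ R (suc c) ≡ inD μ (suc c) (suc R)
  inD-beyond {R} m<R c with R ≤? suc c
  ... | yes R≤c rewrite ≤⇒≤ᵇ≡true (≤-trans (s≤s z≤n) m<R) | ≤⇒≤ᵇ≡true R≤c | >⇒≤ᵇ≡false m<R
    with suc c ≤? suc R
  ...   | yes c≤R rewrite ≤⇒≤ᵇ≡true c≤R | >⇒≤ᵇ≡false (≤-trans m<R R≤c) = refl
  ...   | no c≰R rewrite >⇒≤ᵇ≡false (≰⇒> c≰R) | >⇒≤ᵇ≡false (m<n⇒m<1+n m<R) = refl
  inD-beyond {R} m<R c | no R≰c
    rewrite ≤⇒≤ᵇ≡true (≤-trans (s≤s z≤n) m<R) | >⇒≤ᵇ≡false (≰⇒> R≰c)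
          | ≤⇒≤ᵇ≡true (m≤n⇒m≤1+n (<⇒≤ (≰⇒> R≰c))) = refl

  rowLen-≤m : ∀ {r} → 1 ≤ r → r ≤ m → rowLen μ r ≡ r + a r
  rowLen-≤m {r} 1≤r r≤m = begin
    length (filterᵇ (inD μ r) (map suc (upTo N)))
      ≡⟨ cong length (filterᵇ-cong-map suc (inD-row 1≤r r≤m) (upTo N)) ⟩
    length (filterᵇ (_≤ᵇ r + a r) (map suc (upTo N)))
      ≡⟨ length-filterᵇ-≤ᵇ (r + a r) N ⟩
    (r + a r) ⊓ N
      ≡⟨ m≤n⇒m⊓n≡m (r+a≤N r≤m) ⟩
    r + a r
      ∎
    where open ≡-Reasoning

  colLen-≤m : ∀ {c} → suc c ≤ m → colLen μ (suc c) ≡ c + a (suc c)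
  colLen-≤m {c} c<m = begin
    length (filterᵇ (λ r → inD μ r (suc c)) (map suc (upTo N)))
      ≡⟨ cong length (filterᵇ-cong-map suc (inD-col c<m) (upTo N)) ⟩
    length (filterᵇ (_≤ᵇ c + a (suc c)) (map suc (upTo N)))
      ≡⟨ length-filterᵇ-≤ᵇ (c + a (suc c)) N ⟩
    (c + a (suc c)) ⊓ N
      ≡⟨ m≤n⇒m⊓n≡m (≤-trans (n≤1+n _) (r+a≤N c<m)) ⟩
    c + a (suc c)
      ∎
    where open ≡-Reasoning

  rowLen≡colLen-suc : ∀ {R} → m < R → rowLen μ R ≡ colLen μ (suc R)
  rowLen≡colLen-suc m<R = cong length (filterᵇ-cong-map suc (inD-beyond m<R) (upTo N))

  hookLen-inner : ∀ {r c} → 1 ≤ r → r ≤ m → 1 ≤ c → c ≤ m → c < r + a r → r < c + a c →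
                  hookLen μ (r , c) ≡ a r + a c
  hookLen-inner {suc r} {suc c} _ r<m _ c<m (s≤s c<r+a) (s≤s r<c+a)
    rewrite rowLen-≤m (s≤s z≤n) r<m | colLen-≤m c<m =
    [r+A∸c]+[c+B∸1+r]+1≡A+B {r} {c} (a (suc r)) (a (suc c)) (<⇒≤ c<r+a) r<c+a

  hookLen-transpose : ∀ {r c} → 1 ≤ r → r < c → c ≤ m → hookLen μ (r , c) ≡ hookLen μ (c , r)
  hookLen-transpose {r} {c} 1≤r r<c c≤m = begin
    hookLen μ (r , c) ≡⟨ hookLen-inner 1≤r r≤m 1≤c c≤m c<r+a r<c+a ⟩
    a r + a c         ≡⟨ +-comm (a r) (a c) ⟩
    a c + a r         ≡⟨ hookLen-inner 1≤c c≤m 1≤r r≤m r<c+a c<r+a ⟨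
    hookLen μ (c , r) ∎
    where
    open ≡-Reasoning
    r≤m = ≤-trans (<⇒≤ r<c) c≤m
    1≤c = ≤-trans 1≤r (<⇒≤ r<c)
    c<r+a = ≤⇒<+part 1≤r (<⇒≤ r<c) c≤m
    r<c+a = <-≤-trans r<c (m≤m+n c (a c))

  hookLen-beyond : ∀ {C R} → 1 ≤ C → C ≤ m → m < R → hookLen μ (C , suc R) ≡ hookLen μ (R , C)
  hookLen-beyond {suc C} {R} _ C<m m<R
    rewrite rowLen-≤m (s≤s z≤n) C<m | colLen-≤m C<m | rowLen≡colLen-suc m<R =
    cong (_+ 1) (+-comm (C + a (suc C) ∸ R) (colLen μ (suc R) ∸ suc C))

  inB⇔ : ∀ {r c} → inB μ (r , c) ≡ true ⇔ (1 ≤ r × r ≤ m × r < c × c ≤ r + a r × c ≢ suc m)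
  inB⇔ = ≤ᵇ≡true⇔≤ ∧-⇔ ≤ᵇ≡true⇔≤ ∧-⇔ <ᵇ≡true⇔< ∧-⇔ ≤ᵇ≡true⇔≤ ∧-⇔ not[≡ᵇ]≡true⇔≢

  inD⇔-below : ∀ {R C} → C < R → inD μ R C ≡ true ⇔ (1 ≤ R × 1 ≤ C × C ≤ m × R < C + a C)
  inD⇔-below C<R rewrite >⇒≤ᵇ≡false C<R =
    ≤ᵇ≡true⇔≤ ∧-⇔ ≤ᵇ≡true⇔≤ ∧-⇔ ≤ᵇ≡true⇔≤ ∧-⇔ <ᵇ≡true⇔<

  inNB⇔ : ∀ {R C} → inNB μ (R , C) ≡ true ⇔ (C < R × 1 ≤ C × C ≤ m × R < C + a C)
  inNB⇔ {R} {C} = mk⇔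
    (λ e → let C<R = to <ᵇ≡true⇔< (∧-conicalˡ (C <ᵇ R) (inD μ R C) e)
           in C<R , proj₂ (to (inD⇔-below C<R) (∧-conicalʳ (C <ᵇ R) (inD μ R C) e)))
    (λ (C<R , 1≤C , rest) → cong₂ _∧_ (from <ᵇ≡true⇔< C<R)
                                     (from (inD⇔-below C<R) (≤-trans 1≤C (<⇒≤ C<R) , 1≤C , rest)))

  inB⇔inNB-inner : ∀ {R C} → R ≤ m → inB μ (C , R) ≡ true ⇔ inNB μ (R , C) ≡ true
  inB⇔inNB-inner R≤m = mk⇔
    (λ e → let 1≤C , _ , C<R , _ = to inB⇔ e
           in from inNB⇔ (C<R , 1≤C , ≤-trans (<⇒≤ C<R) R≤m , ≤⇒<+part 1≤C (<⇒≤ C<R) R≤m))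
    (λ e → let C<R , 1≤C , C≤m , R<C+a = to inNB⇔ e
           in from inB⇔ (1≤C , C≤m , C<R , <⇒≤ R<C+a , <⇒≢ (s≤s R≤m)))

  inB⇔inNB-beyond : ∀ {R C} → m < R → inB μ (C , suc R) ≡ true ⇔ inNB μ (R , C) ≡ true
  inB⇔inNB-beyond m<R = mk⇔
    (λ e → let 1≤C , C≤m , _ , R<C+a , _ = to inB⇔ e
           in from inNB⇔ (≤-<-trans C≤m m<R , 1≤C , C≤m , R<C+a))
    (λ e → let C<R , 1≤C , C≤m , R<C+a = to inNB⇔ e
           in from inB⇔ (1≤C , C≤m , m<n⇒m<1+n C<R , R<C+a , >⇒≢ m<R ∘ suc-injective))

  zstar⁻¹ : Node → Node
  zstar⁻¹ (R , C) = if R ≤ᵇ m then (C , R) else (C , suc R)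

  zstar-inner : ∀ {r c} → c ≤ m → zstar μ (r , c) ≡ (c , r)
  zstar-inner c≤m rewrite ≤⇒≤ᵇ≡true c≤m = refl

  zstar-beyond : ∀ {r c} → m < c → zstar μ (r , suc c) ≡ (c , r)
  zstar-beyond m<c rewrite >⇒≤ᵇ≡false (m<n⇒m<1+n m<c) = refl

  zstar⁻¹-inner : ∀ {R C} → R ≤ m → zstar⁻¹ (R , C) ≡ (C , R)
  zstar⁻¹-inner R≤m rewrite ≤⇒≤ᵇ≡true R≤m = refl

  zstar⁻¹-beyond : ∀ {R C} → m < R → zstar⁻¹ (R , C) ≡ (C , suc R)
  zstar⁻¹-beyond m<R rewrite >⇒≤ᵇ≡false m<R = refl

  zstar-zstar⁻¹ : ∀ w → zstar μ (zstar⁻¹ w) ≡ w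
  zstar-zstar⁻¹ (R , C) with R ≤? m
  ... | yes R≤m rewrite zstar⁻¹-inner {C = C} R≤m = zstar-inner R≤m
  ... | no R≰m rewrite zstar⁻¹-beyond {C = C} (≰⇒> R≰m) = zstar-beyond (≰⇒> R≰m)

  zstar⁻¹-zstar : ∀ {r c} → c ≢ suc m → zstar⁻¹ (zstar μ (r , c)) ≡ (r , c)
  zstar⁻¹-zstar {r} {c} c≢1+m with c ≤? m
  ... | yes c≤m rewrite zstar-inner {r} c≤m = zstar⁻¹-inner c≤m
  zstar⁻¹-zstar {r} {zero} c≢1+m | no 0≰m = contradiction z≤n 0≰m
  zstar⁻¹-zstar {r} {suc c} c≢1+m | no c≰m
    rewrite zstar-beyond {r} (≰∧≢⇒> c≰m c≢1+m) = zstar⁻¹-beyond (≰∧≢⇒> c≰m c≢1+m)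

  hookLen-zstar : ∀ {z} → inB μ z ≡ true → hookLen μ (zstar μ z) ≡ hookLen μ z
  hookLen-zstar {r , c} e with to inB⇔ e | c ≤? m
  ... | 1≤r , _ , r<c , _ , _ | yes c≤m rewrite zstar-inner {r} c≤m = sym (hookLen-transpose 1≤r r<c c≤m)
  hookLen-zstar {r , zero}  e | _ | no 0≰m = contradiction z≤n 0≰m
  hookLen-zstar {r , suc c} e | 1≤r , r≤m , _ , _ , c≢1+m | no c≰m
    rewrite zstar-beyond {r} (≰∧≢⇒> c≰m c≢1+m) = sym (hookLen-beyond 1≤r r≤m (≰∧≢⇒> c≰m c≢1+m))

  ∈-box : ∀ {r c} → 1 ≤ r → r ≤ N → 1 ≤ c → c ≤ N → (r , c) ∈ box μ
  ∈-box {suc r} {suc c} _ r<N _ c<N =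
    ∈-cartesianProduct⁺ (∈-map⁺ suc (∈-upTo⁺ r<N)) (∈-map⁺ suc (∈-upTo⁺ c<N))

  inB⇒∈box : ∀ {z} → inB μ z ≡ true → z ∈ box μ
  inB⇒∈box e =
    let 1≤r , r≤m , r<c , c≤r+a , _ = to inB⇔ e
    in ∈-box 1≤r (≤-trans r≤m m≤N) (≤-trans 1≤r (<⇒≤ r<c)) (≤-trans c≤r+a (r+a≤N r≤m))

  unique-box : Unique (box μ)
  unique-box = Unique.cartesianProduct⁺ unique-range unique-range
    where unique-range = Unique.map⁺ suc-injective (Unique.upTo⁺ N)

  inB⇒zstar⁻¹-zstar : ∀ {z} → inB μ z ≡ true → zstar⁻¹ (zstar μ z) ≡ z
  inB⇒zstar⁻¹-zstar {r , c} e = let _ , _ , _ , _ , c≢1+m = to (inB⇔ {r} {c}) e in zstar⁻¹-zstar c≢1+m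

  inNB⇒∈box : ∀ {w} → inNB μ w ≡ true → w ∈ box μ
  inNB⇒∈box e =
    let C<R , 1≤C , C≤m , R<C+a = to inNB⇔ e
    in ∈-box (≤-trans 1≤C (<⇒≤ C<R)) (≤-trans (<⇒≤ R<C+a) (r+a≤N C≤m)) 1≤C (≤-trans C≤m m≤N)

  handRes : ℕ → ℕ → ℕ
  handRes d r = res d r (rowLen μ r)

  footRes : ℕ → ℕ → ℕ
  footRes d c = res d (colLen μ c) c

  inH⇔ : ∀ {d i j r c} →
         inH d μ i j (r , c) ≡ true ⇔ (handRes d r ≡ i × footRes d c ≡ res d 0 (suc j))
  inH⇔ = ≡ᵇ≡true⇔≡ ∧-⇔ ≡ᵇ≡true⇔≡

  module _ (k : ℕ) where

    handRes⇔footRes : ∀ {c i} → 1 ≤ c → c ≤ m → i < suc k →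
      handRes (suc k) c ≡ i ⇔ footRes (suc k) c ≡ res (suc k) 0 (suc (star (suc k) i))
    handRes⇔footRes {suc c} {i} _ c<m i<d rewrite rowLen-≤m (s≤s z≤n) c<m | colLen-≤m c<m =
      res-adjacent-⇔ k (suc c) (suc c + a (suc c)) (c + a (suc c)) (suc c) (adjacent c (a (suc c)))
        i<d (oneMinus-star k i<d)
      where
      adjacent : ∀ c a → suc c + a + suc c ≡ suc (suc c + (c + a))
      adjacent = solve-∀

    footRes⇔handRes : ∀ {c j} → 1 ≤ c → c ≤ m → j < suc k →
      footRes (suc k) c ≡ res (suc k) 0 (suc j) ⇔ handRes (suc k) c ≡ star (suc k) j
    footRes⇔handRes {suc c} {j} _ c<m j<d rewrite rowLen-≤m (s≤s z≤n) c<m | colLen-≤m c<m =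
      res-adjacent-⇔ k (c + a (suc c)) (suc c) (suc c) (suc c + a (suc c)) (adjacent c (a (suc c)))
        (res<d k 0 (suc j)) (oneMinus-res-suc k j<d)
      where
      adjacent : ∀ c a → suc c + (suc c + a) ≡ suc (c + a + suc c)
      adjacent = solve-∀

    footRes⇔handRes-beyond : ∀ {c j} → m < c → j < suc k →
      footRes (suc k) (suc c) ≡ res (suc k) 0 (suc j) ⇔ handRes (suc k) c ≡ star (suc k) j
    footRes⇔handRes-beyond {c} {j} m<c j<d rewrite rowLen≡colLen-suc m<c =
      res-adjacent-⇔ k (colLen μ (suc c)) (suc c) c (colLen μ (suc c))
        (cong suc (+-comm c (colLen μ (suc c)))) (res<d k 0 (suc j)) (oneMinus-res-suc k j<d)

    module _ {i j} (i<d : i < suc k) (j<d : j < suc k) where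

      Bij : Node → Bool
      Bij = inBij (suc k) μ i j

      NBij : Node → Bool
      NBij = inNBij (suc k) μ (star (suc k) j) (star (suc k) i)

      H : Node → Bool
      H = inH (suc k) μ i j

      H* : Node → Bool
      H* = inH (suc k) μ (star (suc k) j) (star (suc k) i)

      Bij⇒inB : ∀ z → Bij z ≡ true → inB μ z ≡ true
      Bij⇒inB z = ∧-conicalˡ (inB μ z) (H z)

      NBij⇒inNB : ∀ w → NBij w ≡ true → inNB μ w ≡ true
      NBij⇒inNB w = ∧-conicalˡ (inNB μ w) (H* w)

      H⇔H*-inner : ∀ {R C} → 1 ≤ C → C < R → R ≤ m → H (C , R) ≡ true ⇔ H* (R , C) ≡ true
      H⇔H*-inner {R} {C} 1≤C C<R R≤m = ⇔-sym (inH⇔ {r = R} {C}) ⇔-∘ (swap ⇔-∘ inH⇔ {r = C} {R})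
        where
        swap = ⇔-swap-× (handRes⇔footRes 1≤C (≤-trans (<⇒≤ C<R) R≤m) i<d)
                        (footRes⇔handRes (≤-trans (s≤s z≤n) C<R) R≤m j<d)

      H⇔H*-beyond : ∀ {R C} → 1 ≤ C → C ≤ m → m < R → H (C , suc R) ≡ true ⇔ H* (R , C) ≡ true
      H⇔H*-beyond {R} {C} 1≤C C≤m m<R =
        ⇔-sym (inH⇔ {r = R} {C}) ⇔-∘ (swap ⇔-∘ inH⇔ {r = C} {suc R})
        where
        swap = ⇔-swap-× (handRes⇔footRes 1≤C C≤m i<d) (footRes⇔handRes-beyond m<R j<d)

      Bij-zstar⁻¹⇔NBij : ∀ w → Bij (zstar⁻¹ w) ≡ true ⇔ NBij w ≡ true
      Bij-zstar⁻¹⇔NBij (R , C) with R ≤? m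
      ... | yes R≤m rewrite zstar⁻¹-inner {C = C} R≤m = ∧-cong-⇔ (inB⇔inNB-inner R≤m)
              (λ e → let 1≤C , _ , C<R , _ = to (inB⇔ {C} {R}) e in H⇔H*-inner 1≤C C<R R≤m)
      ... | no R≰m rewrite zstar⁻¹-beyond {C = C} (≰⇒> R≰m) = ∧-cong-⇔ (inB⇔inNB-beyond m<R)
              (λ e → let 1≤C , C≤m , _ = to (inB⇔ {C} {suc R}) e in H⇔H*-beyond 1≤C C≤m m<R)
        where m<R = ≰⇒> R≰m

      Bij⇒NBij-zstar : ∀ {z} → Bij z ≡ true → NBij (zstar μ z) ≡ true
      Bij⇒NBij-zstar {z} e =
        to (Bij-zstar⁻¹⇔NBij (zstar μ z))
           (subst (λ z′ → Bij z′ ≡ true) (sym (inB⇒zstar⁻¹-zstar {z} (Bij⇒inB z e))) e)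

      NBij⇔zstar-image : ∀ w → NBij w ≡ true ⇔ (∃[ z ] ((Bij z ≡ true) × (zstar μ z ≡ w)))
      NBij⇔zstar-image w = mk⇔
        (λ e → zstar⁻¹ w , from (Bij-zstar⁻¹⇔NBij w) e , zstar-zstar⁻¹ w)
        (λ { (z , e , refl) → Bij⇒NBij-zstar {z} e })

      hookLens-NBij↭hookLens-Bij :
        map (hookLen μ) (filterᵇ NBij (box μ)) ↭ map (hookLen μ) (filterᵇ Bij (box μ))
      hookLens-NBij↭hookLens-Bij =
        subst (map (hookLen μ) NBs ↭_) hookLen∘zstar≡hookLen (↭.map⁺ (hookLen μ) NBs↭zstar[Bs])
        where
        NBs = filterᵇ NBij (box μ)
        Bs = filterᵇ Bij (box μ)
        inB-of-Bs : All (λ z → inB μ z ≡ true) Bs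
        inB-of-Bs = All.map (λ {z} → Bij⇒inB z) (all-filterᵇ Bij (box μ))
        NBs↭zstar[Bs] : NBs ↭ map (zstar μ) Bs
        NBs↭zstar[Bs] = filterᵇ↭map {p = NBij} {Bij} {zstar μ} {zstar⁻¹} unique-box unique-box
          (λ {w} → inNB⇒∈box ∘ NBij⇒inNB w) (λ {z} → inB⇒∈box ∘ Bij⇒inB z)
          (λ {z} → inB⇒zstar⁻¹-zstar ∘ Bij⇒inB z) NBij⇔zstar-image
        hookLen∘zstar≡hookLen : map (hookLen μ) (map (zstar μ) Bs) ≡ map (hookLen μ) Bs
        hookLen∘zstar≡hookLen =
          trans (sym (map-∘ Bs)) (map-cong-local (All.map (λ {z} → hookLen-zstar {z}) inB-of-Bs))

corollary3p2 : (d : ℕ) → 3 ≤ d → d % 2 ≡ 1 →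
    (μ : List ℕ) → Linked _>_ μ → All (λ a → 0 < a) μ →
    (i j : ℕ) → i < d → j < d →
    ((w : Node) →
       (inNBij d μ (star d j) (star d i) w ≡ true)
       ⇔ (∃[ z ] ((inBij d μ i j z ≡ true) × (zstar μ z ≡ w))))
    × (map (hookLen μ) (filterᵇ (inNBij d μ (star d j) (star d i)) (box μ))
       ↭ map (hookLen μ) (filterᵇ (inBij d μ i j) (box μ)))
corollary3p2 zero    ()
corollary3p2 (suc k) _ _ μ decreasing positive i j i<d j<d =
  NBij⇔zstar-image k i<d j<d , hookLens-NBij↭hookLens-Bij k i<d j<d
  where open BarDiagram μ decreasing positive
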